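{- Let $(G,T;A,B)$ be a quasicomb and $F$ a minimum join. Then every path between two vertices $x,y\in A$ has $F$-weight at least $0$; every path between $x\in A$ and $y\in B$ has $F$-weight at least $-1$; and every path between two vertices $x,y\in B$ has $F$-weight at least $-2$. (Equivalently, the $F$-distance $\mathrm{dist}_F(x,y)$ is $\ge 0$, $\ge -1$, $\ge -2$ in the respective cases.)
   Context: Graphs are finite, possibly with multiple edges. A join of $(G,T)$ is $F\subseteq E(G)$ with $|\delta_G(v)\cap F|$ odd iff $v\in T$; $\nu(G,T)$ is the minimum join size; a minimum join is a join of that size. $(G,T;A,B)$ is a bipartite graft with ordered color classes $A,B$; it is a quasicomb if $\nu(G,T)=|B\cap T|$. $w_F(e)=-1$ for $e\in F$ and $1$ otherwise; the $F$-weight of a path is the sum of $w_F$ over its edges; the $F$-distance between $x,y$ is the minimum $F$-weight of a path between them. -}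

module Defs where

open import Data.Nat using (ℕ; _%_; _≤_)
open import Data.Integer using (ℤ; +_; -[1+_]; _+_)
open import Data.Fin using (Fin; _≟_)
open import Data.Fin.Subset.Properties using ()
open import Data.Fin.Subset using (Subset; _∈_; _∉_; _∩_; ∣_∣)
open import Data.Vec using (tabulate; lookup)
open import Data.Bool using (Bool; true; false; _∨_; if_then_else_)
open import Data.Product using (_×_; _,_; proj₁; proj₂; Σ; ∃)
open import Data.Sum using (_⊎_)
open import Data.List using (List; []; _∷_)
open import Data.List.Relation.Unary.Unique.Propositional using (Unique)
open import Relation.Binary.PropositionalEquality using (_≡_)
open import Relation.Nullary using (¬_)
open import Relation.Nullary.Decidable using (⌊_⌋)

record Graph : Set where
  field
    n    : ℕ
    m    : ℕ
    ends : Fin m → Fin n × Fin n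
open Graph public

Vertex : Graph → Set
Vertex G = Fin (n G)

Edge : Graph → Set
Edge G = Fin (m G)

isEnd : (G : Graph) → Vertex G → Edge G → Bool
isEnd G v e = ⌊ v ≟ proj₁ (ends G e) ⌋ ∨ ⌊ v ≟ proj₂ (ends G e) ⌋

-- δ_G(v) as a subset of the edges (no loops occur in bipartite graphs)
δ : (G : Graph) → Vertex G → Subset (m G)
δ G v = tabulate (isEnd G v)

Odd : ℕ → Set
Odd k = k % 2 ≡ 1

IsJoin : (G : Graph) → Subset (n G) → Subset (m G) → Set
IsJoin G T F = (v : Vertex G) → (Odd ∣ δ G v ∩ F ∣ → v ∈ T) × (v ∈ T → Odd ∣ δ G v ∩ F ∣)

IsNu : (G : Graph) → Subset (n G) → ℕ → Set
IsNu G T k = (Σ (Subset (m G)) λ F → IsJoin G T F × ∣ F ∣ ≡ k)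
           × ((F : Subset (m G)) → IsJoin G T F → k ≤ ∣ F ∣)

IsMinJoin : (G : Graph) → Subset (n G) → Subset (m G) → Set
IsMinJoin G T F = IsJoin G T F × ((F' : Subset (m G)) → IsJoin G T F' → ∣ F ∣ ≤ ∣ F' ∣)

IsBipartiteGraft : (G : Graph) → Subset (n G) → Subset (n G) → Subset (n G) → Set
IsBipartiteGraft G T A B =
    ((v : Vertex G) → v ∈ A ⊎ v ∈ B)
  × ((v : Vertex G) → ¬ (v ∈ A × v ∈ B))
  × ((e : Edge G) → (proj₁ (ends G e) ∈ A × proj₂ (ends G e) ∈ B)
                  ⊎ (proj₁ (ends G e) ∈ B × proj₂ (ends G e) ∈ A))

IsQuasicomb : (G : Graph) → Subset (n G) → Subset (n G) → Subset (n G) → Set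
IsQuasicomb G T A B = IsBipartiteGraft G T A B × IsNu G T ∣ B ∩ T ∣

Joins : (G : Graph) → Edge G → Vertex G → Vertex G → Set
Joins G e x y = ends G e ≡ (x , y) ⊎ ends G e ≡ (y , x)

data Walk (G : Graph) : Vertex G → Vertex G → Set where
  [] : {x : Vertex G} → Walk G x x
  step : {x z y : Vertex G} → (e : Edge G) → Joins G e x z → Walk G z y → Walk G x y

verts : {G : Graph} {x y : Vertex G} → Walk G x y → List (Vertex G)
verts {x = x} [] = x ∷ []
verts {x = x} (step e _ w) = x ∷ verts w

IsPath : {G : Graph} {x y : Vertex G} → Walk G x y → Set
IsPath w = Unique (verts w)

wF : {G : Graph} → Subset (m G) → Edge G → ℤ
wF F e = if lookup F e then -[1+ 0 ] else (+ 1)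

weight : {G : Graph} {x y : Vertex G} → Subset (m G) → Walk G x y → ℤ
weight F [] = + 0
weight {G} F (step e _ w) = wF {G} F e + weight F w

-- Every edge has exactly one end in B, so summing the F-degrees over B counts each edge of F
-- at most once, while every vertex of B ∩ T has odd, hence positive, F-degree. Since
-- |F| = ν(G,T) = |B ∩ T|, both estimates are tight: every vertex of B meets at most one edge
-- of F. Along a path, the two edges at an inner vertex of B therefore never both lie in F,
-- so each pass A → B → A has weight at least 0, and only a first or last edge at an end in
-- B can contribute an unmatched -1.
module Submission where

open import Defs
open import Data.Bool using (Bool; true; false; _∧_; _∨_; if_then_else_)
open import Data.Empty using (⊥; ⊥-elim)
open import Data.Fin using (Fin; _≟_)
open import Data.Fin.Subset using (Subset; _∈_; _∩_; ∣_∣)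
open import Data.Fin.Subset.Properties using (x∈p∩q⁺; x∈p∩q⁻)
open import Data.List.Relation.Unary.All using (All; _∷_)
open import Data.List.Relation.Unary.AllPairs using (_∷_)
open import Data.Product using (_×_; _,_; proj₁; proj₂; ∃-syntax)
open import Data.Sum using (_⊎_; inj₁; inj₂)
import Data.Product as Product
import Data.Sum as Sum
open import Data.Vec using (lookup)
open import Data.Vec.Properties using (lookup∘tabulate; []=⇒lookup; lookup⇒[]=)
open import Function using (_∘_; id)
open import Relation.Binary.PropositionalEquality using (_≡_; _≢_; refl; sym; trans; cong; subst)
open import Relation.Nullary using (¬_; yes; no)
open import Relation.Nullary.Decidable using (⌊_⌋)

isEnd⇒endpoint : ∀ {k} (v a b : Fin k) → ⌊ v ≟ a ⌋ ∨ ⌊ v ≟ b ⌋ ≡ true → v ≡ a ⊎ v ≡ b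
isEnd⇒endpoint v a b isEnd with v ≟ a | v ≟ b | isEnd
... | yes v≡a | _       | _ = inj₁ v≡a
... | no _    | yes v≡b | _ = inj₂ v≡b

endpoint⇒isEnd : ∀ {k} (v a b : Fin k) → v ≡ a ⊎ v ≡ b → ⌊ v ≟ a ⌋ ∨ ⌊ v ≟ b ⌋ ≡ true
endpoint⇒isEnd v a b v-end with v ≟ a | v ≟ b
... | yes _   | _       = refl
... | no _    | yes _   = refl
... | no v≢a  | no v≢b  = ⊥-elim (Sum.[ v≢a , v≢b ]′ v-end)

module _ {G : Graph} where

  ∈δ⁺ : ∀ {v e} → v ≡ proj₁ (ends G e) ⊎ v ≡ proj₂ (ends G e) → e ∈ δ G v
  ∈δ⁺ {v} {e} v-end = lookup⇒[]= e (δ G v) (trans (lookup∘tabulate (isEnd G v) e) (endpoint⇒isEnd v _ _ v-end))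

  ∈δ⁻ : ∀ {v e} → e ∈ δ G v → v ≡ proj₁ (ends G e) ⊎ v ≡ proj₂ (ends G e)
  ∈δ⁻ {v} {e} e∈δv = isEnd⇒endpoint v _ _ (trans (sym (lookup∘tabulate (isEnd G v) e)) ([]=⇒lookup e∈δv))

  joins⇒∈δˡ : ∀ {e u v} → Joins G e u v → e ∈ δ G u
  joins⇒∈δˡ (inj₁ ends≡uv) = ∈δ⁺ (inj₁ (sym (cong proj₁ ends≡uv)))
  joins⇒∈δˡ (inj₂ ends≡vu) = ∈δ⁺ (inj₂ (sym (cong proj₂ ends≡vu)))

  joins⇒∈δʳ : ∀ {e u v} → Joins G e u v → e ∈ δ G v
  joins⇒∈δʳ (inj₁ ends≡uv) = ∈δ⁺ (inj₂ (sym (cong proj₂ ends≡uv)))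
  joins⇒∈δʳ (inj₂ ends≡vu) = ∈δ⁺ (inj₁ (sym (cong proj₁ ends≡vu)))

  joins-joins⇒≡ : ∀ {e x z y} → Joins G e x z → Joins G e z y → x ≡ z ⊎ x ≡ y
  joins-joins⇒≡ (inj₁ p) (inj₁ q) = inj₁ (cong proj₁ (trans (sym p) q))
  joins-joins⇒≡ (inj₁ p) (inj₂ q) = inj₂ (cong proj₁ (trans (sym p) q))
  joins-joins⇒≡ (inj₂ p) (inj₁ q) = inj₂ (cong proj₂ (trans (sym p) q))
  joins-joins⇒≡ (inj₂ p) (inj₂ q) = inj₁ (cong proj₂ (trans (sym p) q))

  head∉verts : ∀ {x y} (P : Walk G x y) {u} → All (u ≢_) (verts P) → u ≢ x
  head∉verts []           (u≢x ∷ _) = u≢x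
  head∉verts (step _ _ _) (u≢x ∷ _) = u≢x

  joins-joins⇒≢ : ∀ {e₁ e₂ x z y} → Joins G e₁ x z → Joins G e₂ z y → x ≢ z → x ≢ y → e₁ ≢ e₂
  joins-joins⇒≢ j₁ j₂ x≢z x≢y refl = Sum.[ x≢z , x≢y ]′ (joins-joins⇒≡ j₁ j₂)

module Bipartite {G : Graph} {T A B : Subset (n G)} (bipartite : IsBipartiteGraft G T A B) where

  ∈A⇒∉B : ∀ {v} → v ∈ A → ¬ v ∈ B
  ∈A⇒∉B v∈A v∈B = proj₁ (proj₂ bipartite) _ (v∈A , v∈B)

  Crosses : Vertex G → Vertex G → Set
  Crosses x y = (x ∈ A × y ∈ B) ⊎ (x ∈ B × y ∈ A)

  joins⇒crosses : ∀ {e u v} → Joins G e u v → Crosses u v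
  joins⇒crosses {e} (inj₁ ends≡uv) =
    subst (λ ends → Crosses (proj₁ ends) (proj₂ ends)) ends≡uv (proj₂ (proj₂ bipartite) e)
  joins⇒crosses {e} (inj₂ ends≡vu) =
    Sum.map Product.swap Product.swap (Sum.swap (joins⇒crosses {e} (inj₁ ends≡vu)))

  joins-A⇒B : ∀ {e u v} → Joins G e u v → u ∈ A → v ∈ B
  joins-A⇒B j u∈A with joins⇒crosses j
  ... | inj₁ (_ , v∈B) = v∈B
  ... | inj₂ (u∈B , _) = ⊥-elim (∈A⇒∉B u∈A u∈B)

  joins-B⇒A : ∀ {e u v} → Joins G e u v → u ∈ B → v ∈ A
  joins-B⇒A j u∈B with joins⇒crosses j
  ... | inj₁ (u∈A , _) = ⊥-elim (∈A⇒∉B u∈A u∈B)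
  ... | inj₂ (_ , v∈A) = v∈A

  ∈A-∈B⇒≢ : ∀ {u v} → u ∈ A → v ∈ B → v ≢ u
  ∈A-∈B⇒≢ u∈A v∈B refl = ∈A⇒∉B u∈A v∈B

  end-in-B-unique : (e : Edge G) → ∃[ a ] (∀ {v} → v ∈ B → e ∈ δ G v → v ≡ a)
  end-in-B-unique e with proj₂ (proj₂ bipartite) e
  ... | inj₁ (x∈A , _) = proj₂ (ends G e) , λ v∈B e∈δv → Sum.[ ⊥-elim ∘ ∈A-∈B⇒≢ x∈A v∈B , id ]′ (∈δ⁻ e∈δv)
  ... | inj₂ (_ , y∈A) = proj₁ (ends G e) , λ v∈B e∈δv → Sum.[ id , ⊥-elim ∘ ∈A-∈B⇒≢ y∈A v∈B ]′ (∈δ⁻ e∈δv)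

module Counting where
  open import Data.Nat using (ℕ; zero; suc; _+_; _*_; _≤_; _<_; z≤n; s≤s)
  open import Data.Nat.Properties
    using (+-0-commutativeMonoid; +-*-semiring; +-identityʳ; *-identityˡ; +-mono-≤; +-mono-<-≤;
           ≤-reflexive; <-irrefl; ≮⇒≥; <-≤-trans; ≤-<-trans; module ≤-Reasoning)
  open import Algebra.Properties.CommutativeMonoid.Sum +-0-commutativeMonoid
    using (sum; sum-syntax; sum-remove; sum-cong-≗; sum-replicate-zero; ∑-comm)
  open import Algebra.Properties.Semiring.Sum +-*-semiring using (*-distribˡ-sum)
  open import Data.Fin using (zero; suc; punchIn)
  open import Data.Fin.Properties using (punchInᵢ≢i)
  open import Data.Fin.Subset using (_-_; ⁅_⁆)
  open import Data.Fin.Subset.Properties using (x∈⁅y⁆⇒x≡y; ∣⁅x⁆∣≡1; p⊆q⇒∣p∣≤∣q∣; x∈p∧x≢y⇒x∈p-y; x∈p⇒∣p-x∣<∣p∣)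
  open import Data.Vec using ([]; _∷_)
  open import Data.Vec.Properties using (lookup-zipWith)
  open import Data.Vec.Functional using (Vector; removeAt)
  open import Relation.Binary.PropositionalEquality using (module ≡-Reasoning)

  𝟙 : Bool → ℕ
  𝟙 true  = 1
  𝟙 false = 0

  ∣p∣≡∑𝟙 : ∀ {k} (p : Subset k) → ∣ p ∣ ≡ ∑[ i < k ] 𝟙 (lookup p i)
  ∣p∣≡∑𝟙 []          = refl
  ∣p∣≡∑𝟙 (true ∷ p)  = cong suc (∣p∣≡∑𝟙 p)
  ∣p∣≡∑𝟙 (false ∷ p) = ∣p∣≡∑𝟙 p

  x∈p⇒1≤∣p∣ : ∀ {k} {p : Subset k} {x} → x ∈ p → 1 ≤ ∣ p ∣
  x∈p⇒1≤∣p∣ {x = x} x∈p = subst (_≤ _) (∣⁅x⁆∣≡1 x) (p⊆q⇒∣p∣≤∣q∣ (λ y∈⁅x⁆ → subst (_∈ _) (sym (x∈⁅y⁆⇒x≡y x y∈⁅x⁆)) x∈p))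

  ∣p∣≤1⇒x≡y : ∀ {k} {p : Subset k} {x y} → ∣ p ∣ ≤ 1 → x ∈ p → y ∈ p → x ≡ y
  ∣p∣≤1⇒x≡y {p = p} {x} {y} ∣p∣≤1 x∈p y∈p with x ≟ y
  ... | yes x≡y = x≡y
  ... | no  x≢y = ⊥-elim (<-irrefl refl (<-≤-trans 1<∣p∣ ∣p∣≤1))
    where
    1<∣p∣ : 1 < ∣ p ∣
    1<∣p∣ = ≤-<-trans (x∈p⇒1≤∣p∣ (x∈p∧x≢y⇒x∈p-y y∈p (x≢y ∘ sym))) (x∈p⇒∣p-x∣<∣p∣ x∈p)

  ∑-mono-≤ : ∀ {k} {f g : Vector ℕ k} → (∀ i → f i ≤ g i) → sum f ≤ sum g
  ∑-mono-≤ {zero}  _   = z≤n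
  ∑-mono-≤ {suc k} f≤g = +-mono-≤ (f≤g zero) (∑-mono-≤ (f≤g ∘ suc))

  ∑-mono-< : ∀ {k} {f g : Vector ℕ k} {a} → (∀ i → f i ≤ g i) → f a < g a → sum f < sum g
  ∑-mono-< {suc k} {f} {g} {a} f≤g fa<ga = begin-strict
    sum f                     ≡⟨ sum-remove {i = a} f ⟩
    f a + sum (removeAt f a)  <⟨ +-mono-<-≤ fa<ga (∑-mono-≤ (f≤g ∘ punchIn a)) ⟩
    g a + sum (removeAt g a)  ≡⟨ sum-remove {i = a} g ⟨
    sum g                     ∎
    where open ≤-Reasoning

  ∑-concentrated : ∀ {k} {f : Vector ℕ k} (a : Fin k) → (∀ i → i ≢ a → f i ≡ 0) → sum f ≡ f a
  ∑-concentrated {suc k} {f} a vanishes = begin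
    sum f                     ≡⟨ sum-remove {i = a} f ⟩
    f a + sum (removeAt f a)  ≡⟨ cong (f a +_) (sum-cong-≗ (λ i → vanishes _ (punchInᵢ≢i a i))) ⟩
    f a + sum {k} (λ _ → 0)   ≡⟨ cong (f a +_) (sum-replicate-zero k) ⟩
    f a + 0                   ≡⟨ +-identityʳ (f a) ⟩
    f a                       ∎
    where open ≡-Reasoning

  𝟙≤1 : ∀ b → 𝟙 b ≤ 1
  𝟙≤1 true  = s≤s z≤n
  𝟙≤1 false = z≤n

  𝟙*𝟙≡0 : ∀ {b c} → (b ≡ true → c ≡ true → ⊥) → 𝟙 b * 𝟙 c ≡ 0
  𝟙*𝟙≡0 {false}         _        = refl
  𝟙*𝟙≡0 {true}  {false} _        = refl
  𝟙*𝟙≡0 {true}  {true}  not-both = ⊥-elim (not-both refl refl)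

  𝟙*𝟙∧≤𝟙 : ∀ b c d → 𝟙 b * 𝟙 (c ∧ d) ≤ 𝟙 d
  𝟙*𝟙∧≤𝟙 false _     _ = z≤n
  𝟙*𝟙∧≤𝟙 true  false _ = z≤n
  𝟙*𝟙∧≤𝟙 true  true  d = ≤-reflexive (*-identityˡ (𝟙 d))

  odd⇒1≤ : ∀ {k} → Odd k → 1 ≤ k
  odd⇒1≤ {zero}  ()
  odd⇒1≤ {suc k} _ = s≤s z≤n

  ∣S∩T∣<∑ : ∀ {k} (S T : Subset k) (f : Vector ℕ k) {z}
          → (∀ {i} → i ∈ S → i ∈ T → 1 ≤ f i) → z ∈ S → 2 ≤ f z
          → ∣ S ∩ T ∣ < ∑[ i < k ] (𝟙 (lookup S i) * f i)
  ∣S∩T∣<∑ {k} S T f {z} positive z∈S 2≤fz = begin-strict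
    ∣ S ∩ T ∣                          ≡⟨ ∣p∣≡∑𝟙 (S ∩ T) ⟩
    ∑[ i < k ] 𝟙 (lookup (S ∩ T) i)    <⟨ ∑-mono-< {a = z} pointwise strictly-at-z ⟩
    ∑[ i < k ] (𝟙 (lookup S i) * f i)  ∎
    where
    open ≤-Reasoning
    pointwise : ∀ i → 𝟙 (lookup (S ∩ T) i) ≤ 𝟙 (lookup S i) * f i
    pointwise i rewrite lookup-zipWith _∧_ i S T with lookup S i in Si | lookup T i in Ti
    ... | false | _     = z≤n
    ... | true  | false = z≤n
    ... | true  | true  = subst (1 ≤_) (sym (*-identityˡ (f i))) (positive (lookup⇒[]= i S Si) (lookup⇒[]= i T Ti))
    strictly-at-z : 𝟙 (lookup (S ∩ T) z) < 𝟙 (lookup S z) * f z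
    strictly-at-z rewrite []=⇒lookup z∈S = <-≤-trans (s≤s (𝟙≤1 _)) (subst (2 ≤_) (sym (*-identityˡ (f z))) 2≤fz)

  degree : (G : Graph) → Subset (m G) → Vertex G → ℕ
  degree G F v = ∣ δ G v ∩ F ∣

  ∑-degree≤∣F∣ : ∀ {G : Graph} (S : Subset (n G)) (F : Subset (m G))
               → (∀ e → ∃[ a ] (∀ {v} → v ∈ S → e ∈ δ G v → v ≡ a))
               → ∑[ v < n G ] (𝟙 (lookup S v) * degree G F v) ≤ ∣ F ∣
  ∑-degree≤∣F∣ {G} S F end-in-S-unique = begin
    ∑[ v < n G ] (𝟙 (lookup S v) * degree G F v)
      ≡⟨ sum-cong-≗ (λ v → cong (𝟙 (lookup S v) *_) (∣p∣≡∑𝟙 (δ G v ∩ F))) ⟩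
    ∑[ v < n G ] (𝟙 (lookup S v) * ∑[ e < m G ] 𝟙 (lookup (δ G v ∩ F) e))
      ≡⟨ sum-cong-≗ (λ v → *-distribˡ-sum (𝟙 (lookup S v)) (𝟙 ∘ lookup (δ G v ∩ F))) ⟩
    ∑[ v < n G ] ∑[ e < m G ] incidence v e
      ≡⟨ ∑-comm incidence ⟩
    ∑[ e < m G ] ∑[ v < n G ] incidence v e
      ≤⟨ ∑-mono-≤ incidences≤𝟙F ⟩
    ∑[ e < m G ] 𝟙 (lookup F e)
      ≡⟨ ∣p∣≡∑𝟙 F ⟨
    ∣ F ∣ ∎
    where
    open ≤-Reasoning
    incidence : Vertex G → Edge G → ℕ
    incidence v e = 𝟙 (lookup S v) * 𝟙 (lookup (δ G v ∩ F) e)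

    incidences≤𝟙F : ∀ e → ∑[ v < n G ] incidence v e ≤ 𝟙 (lookup F e)
    incidences≤𝟙F e with end-in-S-unique e
    ... | a , unique = begin
      ∑[ v < n G ] incidence v e                            ≡⟨ ∑-concentrated a vanishes ⟩
      incidence a e                                         ≡⟨ cong (λ b → 𝟙 (lookup S a) * 𝟙 b) (lookup-zipWith _∧_ e (δ G a) F) ⟩
      𝟙 (lookup S a) * 𝟙 (lookup (δ G a) e ∧ lookup F e)  ≤⟨ 𝟙*𝟙∧≤𝟙 (lookup S a) (lookup (δ G a) e) (lookup F e) ⟩
      𝟙 (lookup F e)                                        ∎
      where
      vanishes : ∀ v → v ≢ a → incidence v e ≡ 0
      vanishes v v≢a = 𝟙*𝟙≡0 λ v∈S e∈δv∩F →
        v≢a (unique (lookup⇒[]= v S v∈S) (proj₁ (x∈p∩q⁻ _ _ (lookup⇒[]= e (δ G v ∩ F) e∈δv∩F))))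

  quasicomb⇒degree≤1 : ∀ {G T A B F} → IsQuasicomb G T A B → IsMinJoin G T F
                     → ∀ {z} → z ∈ B → degree G F z ≤ 1
  quasicomb⇒degree≤1 {G} {T} {A} {B} {F} (bipartite , (F₀ , F₀-join , ∣F₀∣≡∣B∩T∣) , _) (F-join , F-minimum) z∈B =
    ≮⇒≥ λ 1<degree → <-irrefl refl (begin-strict
      ∣ B ∩ T ∣                                     <⟨ ∣S∩T∣<∑ B T (degree G F) T-positive z∈B 1<degree ⟩
      ∑[ v < n G ] (𝟙 (lookup B v) * degree G F v)  ≤⟨ ∑-degree≤∣F∣ {G} B F (Bipartite.end-in-B-unique {T = T} {A} bipartite) ⟩
      ∣ F ∣                                         ≤⟨ F-minimum F₀ F₀-join ⟩
      ∣ F₀ ∣                                        ≡⟨ ∣F₀∣≡∣B∩T∣ ⟩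
      ∣ B ∩ T ∣                                     ∎)
    where
    open ≤-Reasoning
    T-positive : ∀ {v} → v ∈ B → v ∈ T → 1 ≤ degree G F v
    T-positive _ v∈T = odd⇒1≤ (proj₂ (F-join _) v∈T)

  quasicomb⇒B-meets-F-once : ∀ {G T A B F} → IsQuasicomb G T A B → IsMinJoin G T F
                           → ∀ {z e₁ e₂} → z ∈ B → e₁ ∈ δ G z ∩ F → e₂ ∈ δ G z ∩ F → e₁ ≡ e₂
  quasicomb⇒B-meets-F-once quasicomb minimum z∈B = ∣p∣≤1⇒x≡y (quasicomb⇒degree≤1 quasicomb minimum z∈B)

open Counting using (quasicomb⇒B-meets-F-once)
open import Data.Nat using (z≤n)
open import Data.Integer using (ℤ; +_; -[1+_]; _+_; _≤_; -≤+; +≤+)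
open import Data.Integer.Properties using (+-mono-≤; +-assoc; +-identityˡ; +-identityʳ; ≤-refl; ≤-reflexive; module ≤-Reasoning)

module PathWeight {G : Graph} {T A B : Subset (n G)} {F : Subset (m G)}
  (bipartite : IsBipartiteGraft G T A B)
  (B-meets-F-once : ∀ {z e₁ e₂} → z ∈ B → e₁ ∈ δ G z ∩ F → e₂ ∈ δ G z ∩ F → e₁ ≡ e₂) where

  open Bipartite {T = T} {A} {B} bipartite
  open ≤-Reasoning

  w : Edge G → ℤ
  w = wF {G} F

  ε : Vertex G → ℤ
  ε v = if lookup B v then -[1+ 0 ] else + 0

  ε-A : ∀ {v} → v ∈ A → ε v ≡ + 0
  ε-A {v} v∈A with lookup B v in B[v]
  ... | true  = ⊥-elim (∈A⇒∉B v∈A (lookup⇒[]= v B B[v]))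
  ... | false = refl

  ε-B : ∀ {v} → v ∈ B → ε v ≡ -[1+ 0 ]
  ε-B v∈B rewrite []=⇒lookup v∈B = refl

  -1≤w : ∀ e → -[1+ 0 ] ≤ w e
  -1≤w e with lookup F e
  ... | true  = ≤-refl
  ... | false = -≤+

  0≤w+w : ∀ e₁ e₂ → ¬ (e₁ ∈ F × e₂ ∈ F) → + 0 ≤ w e₁ + w e₂
  0≤w+w e₁ e₂ not-both with lookup F e₁ in F[e₁] | lookup F e₂ in F[e₂]
  ... | true  | true  = ⊥-elim (not-both (lookup⇒[]= e₁ F F[e₁] , lookup⇒[]= e₂ F F[e₂]))
  ... | true  | false = ≤-refl
  ... | false | true  = ≤-refl
  ... | false | false = +≤+ z≤n

  weight-from-A : ∀ {x y} (P : Walk G x y) → x ∈ A → IsPath P → ε y ≤ weight F P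
  weight-from-A [] x∈A _ = ≤-reflexive (ε-A x∈A)
  weight-from-A {y = y} (step e j []) x∈A _ = begin
    ε y        ≡⟨ ε-B (joins-A⇒B j x∈A) ⟩
    -[1+ 0 ]   ≤⟨ -1≤w e ⟩
    w e        ≡⟨ +-identityʳ (w e) ⟨
    w e + + 0  ∎
  weight-from-A {y = y} (step e₁ j₁ (step e₂ j₂ P)) x∈A ((x≢z ∷ x∉P) ∷ _ ∷ P-path) = begin
    ε y                         ≡⟨ +-identityˡ (ε y) ⟨
    + 0 + ε y                   ≤⟨ +-mono-≤ (0≤w+w e₁ e₂ not-both-in-F) (weight-from-A P z′∈A P-path) ⟩
    (w e₁ + w e₂) + weight F P  ≡⟨ +-assoc (w e₁) (w e₂) (weight F P) ⟩
    w e₁ + (w e₂ + weight F P)  ∎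
    where
    z∈B = joins-A⇒B j₁ x∈A
    z′∈A = joins-B⇒A j₂ z∈B
    not-both-in-F : ¬ (e₁ ∈ F × e₂ ∈ F)
    not-both-in-F (e₁∈F , e₂∈F) = joins-joins⇒≢ j₁ j₂ x≢z (head∉verts P x∉P)
      (B-meets-F-once z∈B (x∈p∩q⁺ (joins⇒∈δʳ j₁ , e₁∈F)) (x∈p∩q⁺ (joins⇒∈δˡ j₂ , e₂∈F)))

  weight-from-B : ∀ {x y} (P : Walk G x y) → x ∈ B → IsPath P → -[1+ 0 ] + ε y ≤ weight F P
  weight-from-B [] x∈B _ rewrite ε-B x∈B = -≤+
  weight-from-B (step e j P) x∈B (_ ∷ P-path) = +-mono-≤ (-1≤w e) (weight-from-A P (joins-B⇒A j x∈B) P-path)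

lemma7p4 : (G : Graph) (T A B : Subset (n G)) (F : Subset (m G))
         → IsQuasicomb G T A B → IsMinJoin G T F
         → ((x y : Vertex G) → x ∈ A → y ∈ A → (P : Walk G x y) → IsPath P → + 0 ≤ weight F P)
         × ((x y : Vertex G) → x ∈ A → y ∈ B → (P : Walk G x y) → IsPath P → -[1+ 0 ] ≤ weight F P)
         × ((x y : Vertex G) → x ∈ B → y ∈ B → (P : Walk G x y) → IsPath P → -[1+ 1 ] ≤ weight F P)
lemma7p4 G T A B F quasicomb minimum =
    (λ _ _ x∈A y∈A P path → subst (_≤ weight F P) (ε-A y∈A) (weight-from-A P x∈A path))
  , (λ _ _ x∈A y∈B P path → subst (_≤ weight F P) (ε-B y∈B) (weight-from-A P x∈A path))
  , (λ _ _ x∈B y∈B P path → subst (_≤ weight F P) (cong (λ t → -[1+ 0 ] + t) (ε-B y∈B)) (weight-from-B P x∈B path))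
  where open PathWeight {T = T} (proj₁ quasicomb) (quasicomb⇒B-meets-F-once quasicomb minimum)
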